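{- For any graph $U$, any integer $m\ge 0$, and any integer $h$ with $0\le h\le\chi_2(U)$, the $(h,m)$-boost $U^{(h,m)}$ satisfies $\chi_2(U^{(h,m)})\ge hm+1$.
   Context: A colouring $\varphi:V(G)\to\mathbb{N}$ is a 2-ranking if for every non-trivial path $u_0,\ldots,u_p$ in $G$ of length $p\le 2$, either $\varphi(u_0)\neq\varphi(u_p)$ or $\varphi(u_0)<\max\{\varphi(u_0),\ldots,\varphi(u_p)\}$; $\chi_2(G)$ is the minimum number of colours $\{1,\ldots,k\}$ in a 2-ranking. For a graph $U$ and integers $h,m\ge 0$, the $(h,m)$-boost $U^{(h,m)}$ has vertex set the disjoint union $L_0\cup\cdots\cup L_m$, where $L_0=\{a_0\}$ is a single vertex and, for each $i\in\{1,\ldots,m\}$ and each $a\in L_{i-1}$, $U^{(h,m)}$ contains $hm+1$ disjoint copies $U_{a,0},\ldots,U_{a,hm}$ of $U$ together with all edges $av$ for $v\in\bigcup_{j=0}^{hm}V(U_{a,j})$; $L_i$ is the union over $a\in L_{i-1}$ of the vertex sets of these copies. There are no other edges. -}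

module Defs where

open import Data.Nat using (ℕ; zero; suc; _+_; _*_; _≤_; _<_; _⊔_)
open import Data.Nat.Properties using (n<1+n; <-irrefl)
open import Data.Fin using (Fin)
open import Data.List using (List; []; _∷_; length)
open import Data.Product using (Σ; _×_; _,_; proj₁; proj₂)
open import Data.Sum using (_⊎_)
open import Relation.Binary.PropositionalEquality using (_≡_; _≢_; refl; cong)
open import Relation.Nullary using (¬_)

record Graph : Set₁ where
  field
    V      : Set
    E      : V → V → Set
    E-sym  : ∀ {u v} → E u v → E v u
    E-irr  : ∀ {v} → ¬ E v v

record FinGraph : Set₁ where
  field
    n      : ℕ
    E      : Fin n → Fin n → Set
    E-sym  : ∀ {u v} → E u v → E v u
    E-irr  : ∀ {v} → ¬ E v v

toGraph : FinGraph → Graph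
toGraph U = record { V = Fin n ; E = E ; E-sym = E-sym ; E-irr = E-irr }
  where open FinGraph U

record Is2Ranking (G : Graph) (k : ℕ) (φ : Graph.V G → ℕ) : Set where
  open Graph G
  field
    range : ∀ v → 1 ≤ φ v × φ v ≤ k
    path1 : ∀ u₀ u₁ → E u₀ u₁ → u₀ ≢ u₁ →
            φ u₀ ≢ φ u₁ ⊎ φ u₀ < φ u₀ ⊔ φ u₁
    path2 : ∀ u₀ u₁ u₂ → E u₀ u₁ → E u₁ u₂ →
            u₀ ≢ u₁ → u₁ ≢ u₂ → u₀ ≢ u₂ →
            φ u₀ ≢ φ u₂ ⊎ φ u₀ < φ u₀ ⊔ φ u₁ ⊔ φ u₂

Has2Ranking : Graph → ℕ → Set
Has2Ranking G k = Σ (Graph.V G → ℕ) (Is2Ranking G k)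

χ₂≡ : Graph → ℕ → Set
χ₂≡ G k = Has2Ranking G k × (∀ j → j < k → ¬ Has2Ranking G j)

-- A vertex of level i is encoded as a list of length i of pairs
-- (copy index j ∈ {0..hm}, vertex u of U), most recent step first:
-- the empty list is a₀, and (j , u) ∷ a is the copy of u in U_{a,j}.

module Boost (U : FinGraph) (h m : ℕ) where
  open FinGraph U renaming (E to EU; E-sym to EU-sym; E-irr to EU-irr)

  Step : Set
  Step = Fin (suc (h * m)) × Fin n

  BV : Set
  BV = Σ (List Step) (λ l → length l ≤ m)

  data BE : BV → BV → Set where
    parent : ∀ l s p q → BE (l , p) (s ∷ l , q)
    child  : ∀ l s p q → BE (s ∷ l , q) (l , p)
    inside : ∀ l j u u′ p q → EU u u′ →
             BE ((j , u) ∷ l , p) ((j , u′) ∷ l , q)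

  BE-sym : ∀ {x y} → BE x y → BE y x
  BE-sym (parent l s p q) = child l s p q
  BE-sym (child l s p q) = parent l s p q
  BE-sym (inside l j u u′ p q e) = inside l j u′ u q p (EU-sym e)

  BE-irr : ∀ {v} → ¬ BE v v
  BE-irr (inside l j u .u p q e) = EU-irr e

  graph : Graph
  graph = record { V = BV ; E = BE ; E-sym = BE-sym ; E-irr = BE-irr }

boost : FinGraph → ℕ → ℕ → Graph
boost U h m = Boost.graph U h m

module Submission where

-- Let φ be a 2-ranking of the boost with d ≤ hm colours.  We walk down from
-- the root a₀, finding at every level a child whose colour is at least h
-- below its parent's colour; after m steps the colour of the root is at least
-- hm + 1 > d, a contradiction.  The step at a vertex a rests on three facts
-- about 2-rankings of arbitrary graphs, proved first:
--   * two distinct neighbours of a with equal colour force a above them, so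
--     the neighbours of a coloured higher than a have pairwise distinct
--     colours and there are at most d of them (pigeonhole).  Since a has
--     hm + 1 > d child copies, some copy lies entirely below a;
--   * adjacent vertices have distinct colours;
--   * a copy of U whose colours lie in a window (b, b + k] yields, after
--     subtracting b, a 2-ranking of U with k colours.  As U has no 2-ranking
--     with h - 1 colours, a copy below a cannot fit in the window
--     (φ a - h, φ a), so one of its vertices is coloured ≤ φ a - h.

open import Defs
open import Data.Nat using (ℕ; zero; suc; >-nonZero; s≤s⁻¹; _+_; _*_; _∸_; _⊔_; _≤_; _<_; z≤n; s≤s; _≤?_; _<?_)
open import Data.Nat.Properties
open import Data.Fin using (Fin; fromℕ<)
open import Data.Fin.Properties using (any?; all?; ¬∀⟶∃¬; pigeonhole; fromℕ<-injective)
  renaming (<-irrefl to <-irrefl-Fin)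
open import Data.List using (List; []; _∷_; length)
open import Data.List.Properties using (∷-injectiveˡ)
open import Data.Product using (Σ; _×_; _,_; proj₁; proj₂)
open import Data.Product.Properties using (,-injectiveˡ; ,-injectiveʳ)
open import Data.Sum using (_⊎_; inj₁; inj₂)
open import Relation.Nullary using (¬_; yes; no; contradiction)
open import Relation.Binary.PropositionalEquality using (_≡_; _≢_; refl; sym; trans; cong; cong₂; subst)

record Embedding (G H : Graph) : Set where
  field
    map       : Graph.V G → Graph.V H
    injective : ∀ {u v} → map u ≡ map v → u ≡ v
    edge      : ∀ {u v} → Graph.E G u v → Graph.E H (map u) (map v)

shift-condition : ∀ {b x z M} → b ≤ x → b ≤ z → x ≢ z ⊎ x < M →
                  x ∸ b ≢ z ∸ b ⊎ x ∸ b < M ∸ b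
shift-condition b≤x b≤z (inj₁ x≢z) = inj₁ (λ eq → x≢z (∸-cancelʳ-≡ b≤x b≤z eq))
shift-condition b≤x b≤z (inj₂ x<M) = inj₂ (∸-monoˡ-< x<M b≤x)

window-ranking : ∀ {G H d φ} → Is2Ranking H d φ → (e : Embedding G H) →
                 ∀ b k → (∀ u → b < φ (Embedding.map e u) × φ (Embedding.map e u) ≤ b + k) →
                 Has2Ranking G k
window-ranking {G} {φ = φ} R e b k in-window = ψ , ranking
  where
    open Embedding e using (map; injective; edge)
    y : Graph.V G → ℕ
    y u = φ (map u)
    ψ : Graph.V G → ℕ
    ψ u = y u ∸ b
    b≤y : ∀ u → b ≤ y u
    b≤y u = <⇒≤ (proj₁ (in-window u))
    map-≢ : ∀ {u v} → u ≢ v → map u ≢ map v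
    map-≢ u≢v eq = u≢v (injective eq)
    ranking : Is2Ranking G k ψ
    Is2Ranking.range ranking u =
      m<n⇒0<n∸m (proj₁ (in-window u)) , m≤n+o⇒m∸n≤o (y u) b (proj₂ (in-window u))
    Is2Ranking.path1 ranking u₀ u₁ e₀₁ u₀≢u₁
      rewrite sym (∸-distribʳ-⊔ b (y u₀) (y u₁)) =
      shift-condition (b≤y u₀) (b≤y u₁)
        (Is2Ranking.path1 R (map u₀) (map u₁) (edge e₀₁) (map-≢ u₀≢u₁))
    Is2Ranking.path2 ranking u₀ u₁ u₂ e₀₁ e₁₂ u₀≢u₁ u₁≢u₂ u₀≢u₂
      rewrite sym (∸-distribʳ-⊔ b (y u₀) (y u₁))
            | sym (∸-distribʳ-⊔ b (y u₀ ⊔ y u₁) (y u₂)) =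
      shift-condition (b≤y u₀) (b≤y u₂)
        (Is2Ranking.path2 R (map u₀) (map u₁) (map u₂) (edge e₀₁) (edge e₁₂)
          (map-≢ u₀≢u₁) (map-≢ u₁≢u₂) (map-≢ u₀≢u₂))

-- A colour y strictly below x but within k+1 of it lies in the window
-- (x ∸ (k+1), x ∸ (k+1) + k]; positivity of y covers the case x ≤ k.
below-in-window : ∀ {x y} k → 0 < y → y < x → x < y + suc k →
                  x ∸ suc k < y × y ≤ x ∸ suc k + k
below-in-window {x} {y} k 0<y y<x x<y+k+1 =
  m<n+o⇒m∸n<o x (suc k) {{>-nonZero 0<y}} (subst (x <_) (+-comm y (suc k)) x<y+k+1) ,
  (≤-trans (s≤s⁻¹ (≤-trans y<x (m≤n+m∸n x (suc k))))
           (≤-reflexive (+-comm k (x ∸ suc k))))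

module RankingFacts {G : Graph} {d : ℕ} {φ : Graph.V G → ℕ} (R : Is2Ranking G d φ) where
  open Graph G
  open Is2Ranking R

  adjacent-distinct : ∀ {u v} → E u v → φ u ≢ φ v
  adjacent-distinct {u} {v} e eq with path1 u v e (λ { refl → E-irr e })
  ... | inj₁ φu≢φv = φu≢φv eq
  ... | inj₂ φu<max =
    <-irrefl refl (subst (φ u <_) (trans (cong (φ u ⊔_) (sym eq)) (⊔-idem (φ u))) φu<max)

  twins-below : ∀ {u a w} → E u a → E a w → u ≢ w → φ u ≡ φ w → φ u < φ a
  twins-below {u} {a} {w} eu ew u≢w eq
    with path2 u a w eu ew (λ { refl → E-irr eu }) (λ { refl → E-irr ew }) u≢w
  ... | inj₁ φu≢φw = contradiction eq φu≢φw
  ... | inj₂ φu<max = ≰⇒> a-not-above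
    where
      a-not-above : ¬ (φ a ≤ φ u)
      a-not-above φa≤φu = <-irrefl refl (subst (φ u <_) max-is-φu φu<max)
        where
          max-is-φu : φ u ⊔ φ a ⊔ φ w ≡ φ u
          max-is-φu = trans (cong₂ _⊔_ (m≥n⇒m⊔n≡m φa≤φu) (sym eq)) (⊔-idem (φ u))

  colour-slot : V → Fin d
  colour-slot v = fromℕ< (pred< (range v))
    where
      pred< : ∀ {c} → 1 ≤ c × c ≤ d → c ∸ 1 < d
      pred< (s≤s z≤n , c≤d) = c≤d

  colour-slot-injective : ∀ {u v} → colour-slot u ≡ colour-slot v → φ u ≡ φ v
  colour-slot-injective {u} {v} eq =
    ∸-cancelʳ-≡ (proj₁ (range u)) (proj₁ (range v)) (fromℕ<-injective _ _ _ _ eq)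

  -- Distinct neighbours of a coloured above a have pairwise distinct colours,
  -- hence there are at most d of them.
  higher-neighbours-bounded : ∀ {N a} (f : Fin N → V) → (∀ {i j} → f i ≡ f j → i ≡ j) →
                              (∀ i → E (f i) a) → (∀ i → φ a < φ (f i)) → N ≤ d
  higher-neighbours-bounded {N} {a} f f-injective adjacent higher = ≮⇒≥ too-many
    where
      too-many : ¬ (d < N)
      too-many d<N with pigeonhole d<N (λ i → colour-slot (f i))
      ... | i , j , i<j , same-slot =
        <-asym (higher i)
          (twins-below (adjacent i) (E-sym (adjacent j))
            (λ eq → <-irrefl-Fin (f-injective eq) i<j) (colour-slot-injective same-slot))

module Children (U : FinGraph) (h m : ℕ) where
  open FinGraph U using (n)
  open Boost U h m using (BV; BE; graph; inside) renaming (child to child-edge)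

  child : ∀ l → suc (length l) ≤ m → Fin (suc (h * m)) → Fin n → BV
  child l q j u = ((j , u) ∷ l , q)

  child-adjacent : ∀ {l p q j u} → BE (child l q j u) (l , p)
  child-adjacent {l} {p} {q} {j} {u} = child-edge l (j , u) p q

  child-injective : ∀ {l q j j′ u u′} → child l q j u ≡ child l q j′ u′ → j ≡ j′ × u ≡ u′
  child-injective eq = let step-eq = ∷-injectiveˡ (,-injectiveˡ eq) in
    ,-injectiveˡ step-eq , ,-injectiveʳ step-eq

  copy : ∀ l q (j : Fin (suc (h * m))) → Embedding (toGraph U) graph
  copy l q j = record
    { map       = child l q j
    ; injective = λ eq → proj₂ (child-injective eq)
    ; edge      = λ {u} {u′} e → inside l j u u′ q q e
    }

module Descent (U : FinGraph) (k m : ℕ) (no-k-ranking : ¬ Has2Ranking (toGraph U) k)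
               {d : ℕ} {φ : Boost.BV U (suc k) m → ℕ}
               (R : Is2Ranking (boost U (suc k) m) d φ) (few-colours : d < suc (suc k * m)) where
  open FinGraph U using (n)
  open Boost U (suc k) m using (Step; BV)
  open Children U (suc k) m
  open RankingFacts R
  open Is2Ranking R using (range)

  lower-copy : ∀ l p q → Σ (Fin (suc (suc k * m))) λ j → ∀ u → φ (child l q j u) < φ (l , p)
  lower-copy l p q with all? (λ j → any? (λ u → φ (l , p) <? φ (child l q j u)))
  ... | yes every-copy-high = contradiction
          (higher-neighbours-bounded high-child
             (λ eq → proj₁ (child-injective eq)) (λ _ → child-adjacent)
             (λ j → proj₂ (every-copy-high j)))
          (<⇒≱ few-colours)
    where
      high-child : Fin (suc (suc k * m)) → BV
      high-child j = child l q j (proj₁ (every-copy-high j))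
  ... | no some-copy-low with ¬∀⟶∃¬ _ _ (λ j → any? (λ u → φ (l , p) <? φ (child l q j u))) some-copy-low
  ...   | j , no-high-child = j , λ u →
          ≤∧≢⇒< (≮⇒≥ (λ high → no-high-child (u , high))) (adjacent-distinct child-adjacent)

  drop : ∀ l p q → Σ (Fin (suc (suc k * m))) λ j → Σ (Fin n) λ u →
         φ (child l q j u) + suc k ≤ φ (l , p)
  drop l p q with lower-copy l p q
  ... | j , below with any? (λ u → φ (child l q j u) + suc k ≤? φ (l , p))
  ...   | yes (u , deep) = j , u , deep
  ...   | no none-deep = contradiction
          (window-ranking R (copy l q j) (φ (l , p) ∸ suc k) k λ u →
             below-in-window k (proj₁ (range (child l q j u))) (below u)
               (≰⇒> (λ deep → none-deep (u , deep))))
          no-k-ranking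

  descent : ∀ i → i ≤ m → Σ (List Step) λ l → Σ (length l ≤ m) λ p →
            length l ≡ i × φ (l , p) + suc k * i ≤ φ ([] , z≤n)
  descent zero _ = [] , z≤n , refl ,
    ≤-reflexive (trans (cong (φ ([] , z≤n) +_) (*-zeroʳ (suc k))) (+-identityʳ _))
  descent (suc i) i<m with descent i (<⇒≤ i<m)
  ... | l , p , refl , bound with drop l p i<m
  ...   | j , u , deep = (j , u) ∷ l , i<m , refl , (begin
      φ v + suc k * suc i      ≡⟨ cong (φ v +_) (*-suc (suc k) i) ⟩
      φ v + (suc k + suc k * i) ≡⟨ sym (+-assoc (φ v) (suc k) (suc k * i)) ⟩
      φ v + suc k + suc k * i   ≤⟨ +-monoˡ-≤ (suc k * i) deep ⟩
      φ (l , p) + suc k * i     ≤⟨ bound ⟩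
      φ ([] , z≤n)              ∎)
    where
      open ≤-Reasoning
      v : BV
      v = child l i<m j u

  root-too-high : suc (suc k * m) ≤ φ ([] , z≤n)
  root-too-high with descent m ≤-refl
  ... | l , p , _ , bound = ≤-trans (+-monoˡ-≤ (suc k * m) (proj₁ (range (l , p)))) bound

lemma19 : (U : FinGraph) (h m : ℕ) (c : ℕ) → χ₂≡ (toGraph U) c → h ≤ c →
    (d : ℕ) → χ₂≡ (boost U h m) d → suc (h * m) ≤ d
lemma19 U zero m c _ _ d ((φ , R) , _) =
  ≤-trans (proj₁ (range ([] , z≤n))) (proj₂ (range ([] , z≤n)))
  where open Is2Ranking R using (range)
lemma19 U (suc k) m c χU k<c d ((φ , R) , _) = ≮⇒≥ λ few-colours →
  <⇒≱ few-colours
    (≤-trans (Descent.root-too-high U k m (proj₂ χU k k<c) R few-colours)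
             (proj₂ (Is2Ranking.range R ([] , z≤n))))
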